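{- Let $A_2=\{231,321,4123,21534\}$. For every positive integer $n$ and every integer $k\ge 2$, the number of permutations in $\operatorname{Av}_n(A_2)$ with exactly $k$ inversions is $$\binom{n-k}{k}+\sum_{\ell=k-2}^{n-3}\binom{\ell-(k-2)}{k-2}=\binom{n-k}{k}+\binom{n-k}{k-1}=\binom{n-k+1}{k}.$$
   Context: $\operatorname{Av}_n(S)$ is the set of permutations of length $n$ avoiding every pattern in $S$ (classical pattern avoidance). An inversion of a permutation $\pi$ is a pair of positions $i<j$ with $\pi_i>\pi_j$. Binomial coefficients $\binom{a}{b}$ with integer arguments are taken to be $0$ unless $0\le b\le a$; empty sums are $0$. -}

module Defs where

open import Data.Nat using (ℕ; zero; suc; _<_; _<?_)
open import Data.Nat.Properties using (≡-decSetoid)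
open import Data.Bool using (Bool; true; false; _∧_; if_then_else_)
open import Data.List using (List; []; _∷_; map; filter; length; upTo; concatMap; _++_)
open import Data.Bool.ListAction using (all; any)
open import Data.List.Relation.Unary.Unique.Propositional using (Unique)
open import Data.List.Relation.Unary.Unique.DecPropositional Data.Nat._≟_ using (unique?)
open import Relation.Nullary.Decidable using (⌊_⌋; does)

lists : ℕ → List ℕ → List (List ℕ)
lists zero    xs = [] ∷ []
lists (suc n) xs = concatMap (λ x → map (x ∷_) (lists n xs)) xs

-- The symmetric group S_n as one-line words over {1,…,n}: all words of
-- length n over {1,…,n} with no repeated entry.
perms : ℕ → List (List ℕ)
perms n = filter (λ w → unique? w) (lists n (map suc (upTo n)))

subseqs : List ℕ → List (List ℕ)
subseqs []       = [] ∷ []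
subseqs (x ∷ xs) = map (x ∷_) (subseqs xs) ++ subseqs xs

lt : ℕ → ℕ → Bool
lt b c = does (b <? c)

_==_ : Bool → Bool → Bool
true  == b = b
false == true = false
false == false = true

sameRel : ℕ → ℕ → List ℕ → List ℕ → Bool
sameRel x y []       []       = true
sameRel x y (a ∷ as) (b ∷ bs) = ((lt x a == lt y b) ∧ (lt a x == lt b y)) ∧ sameRel x y as bs
sameRel x y _        _        = false

orderIso : List ℕ → List ℕ → Bool
orderIso []       []       = true
orderIso (x ∷ xs) (y ∷ ys) = sameRel x y xs ys ∧ orderIso xs ys
orderIso _        _        = false

contains : List ℕ → List ℕ → Bool
contains π σ = any (orderIso σ) (subseqs π)

avoidsAll : List (List ℕ) → List ℕ → Bool
avoidsAll S π = all (λ σ → if contains π σ then false else true) S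

Av : ℕ → List (List ℕ) → List (List ℕ)
Av n S = filter (λ π → avoidsAll S π Data.Bool.≟ true) (perms n)

inv : List ℕ → ℕ
inv []       = 0
inv (x ∷ xs) = length (filter (λ y → y <? x) xs) Data.Nat.+ inv xs

A₂ : List (List ℕ)
A₂ = (2 ∷ 3 ∷ 1 ∷ []) ∷ (3 ∷ 2 ∷ 1 ∷ []) ∷ (4 ∷ 1 ∷ 2 ∷ 3 ∷ [])
   ∷ (2 ∷ 1 ∷ 5 ∷ 3 ∷ 4 ∷ []) ∷ []

countInv : List (List ℕ) → ℕ → ℕ → ℕ
countInv S n k = length (filter (λ π → inv π Data.Nat.≟ k) (Av n S))

-- Avoiding 231 and 321 forces a permutation to be a direct sum of blocks k 1 2 … (k−1): at
-- each stage the least unused value must be the first or the second entry, otherwise it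
-- forms a 231 or a 321 with them. Avoiding 4123 leaves the blocks 1, 21 and 312, and since
-- 21534 = 21 ⊕ 312 a 312-block may only be preceded by 1-blocks. Conversely every such block
-- sum avoids A₂: 231, 321 and 4123 are sum-indecomposable, so they can only occur inside a
-- single block. A block of size s has s − 1 inversions, so splitting the admissible block words
-- by their first block gives a(n+1, k) = a(n, k) + ℓ(n−1, k−1) + ℓ(n−2, k−2), where
-- ℓ(m, j) = C(m−j, j) counts the words in 1 and 21 alone; Pascal's rule turns this into
-- C(n−k+1, k), and the hockey-stick identity gives the middle expression.

module Submission where

open import Defs
open import Data.Nat using (ℕ; zero; suc; _+_; _∸_; _≤_; _<_; _≤?_; _<?_; z≤n; s≤s; z<s; _≟_)
open import Data.Nat.Properties
open import Data.Nat.Combinatorics using (_C_; nCk+nC[k+1]≡[n+1]C[k+1]; k>n⇒nCk≡0)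
open import Data.Nat.ListAction using (sum)
open import Data.Nat.ListAction.Properties using (sum-++)
open import Data.Bool as Bool using (Bool; true; false; T; _∧_)
open import Data.Bool.ListAction using (all)
open import Data.Bool.Properties using (T-∧; T-≡; ∧-assoc)
open import Data.Bool.Solver using (module ∨-∧-Solver)
open import Data.List using (List; []; _∷_; map; filter; length; upTo; _++_; take; drop)
open import Data.List.Properties
  using ( ∷-injectiveˡ; ∷-injectiveʳ; ++-cancelˡ; ++-identityʳ; map-++; upTo-∷ʳ
        ; filter-accept; filter-reject; filter-none; filter-++
        ; length-++; length-++-≤ˡ; length-map; length-upTo; length-take; length-drop
        ; take++drop≡id; take-all)
open import Data.List.Membership.Propositional using (_∈_; find; lose)
open import Data.List.Membership.Propositional.Properties
  using ( ∈-++⁺ˡ; ∈-++⁺ʳ; ∈-++⁻; ∈-map⁺; ∈-map⁻; map∷⁻; map∷-decomp∈; ∈-∃++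
        ; ∈-upTo⁺; ∈-upTo⁻; ∈-concatMap⁺; ∈-concatMap⁻; ∈-filter⁺; ∈-filter⁻)
open import Data.List.Membership.Propositional.Properties.WithK using (unique∧set⇒bag)
open import Data.List.Membership.DecPropositional _≟_ using (_∈?_)
open import Data.List.Relation.Unary.All as All using (All; []; _∷_)
import Data.List.Relation.Unary.All.Properties as All
open import Data.List.Relation.Unary.Any using (here; there)
open import Data.List.Relation.Unary.Any.Properties using (any⇔)
import Data.List.Relation.Unary.AllPairs as AllPairs
import Data.List.Relation.Unary.AllPairs.Properties as AllPairs
open import Data.List.Relation.Unary.Unique.Propositional using (Unique; []; _∷_)
import Data.List.Relation.Unary.Unique.Propositional.Properties as Unique
open import Data.List.Relation.Unary.Unique.DecPropositional _≟_ using (unique?)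
open import Data.List.Relation.Binary.Sublist.Propositional
  using (_⊆_; []; _∷_; _∷ʳ_; ⊆-refl; ⊆-trans; from∈)
open import Data.List.Relation.Binary.Sublist.Propositional.Properties
  using (All-resp-⊆; map⁺; ++⁺; ++⁺ˡ; ++⁺ʳ)
open import Data.List.Relation.Binary.Disjoint.Propositional using (Disjoint)
open import Data.List.Relation.Binary.BagAndSetEquality using (∼bag⇒↭)
open import Data.List.Relation.Binary.Permutation.Propositional.Properties using (↭-length)
open import Data.Product using (∃-syntax; _×_; _,_; proj₁; proj₂)
open import Data.Sum using (_⊎_; inj₁; inj₂; [_,_]′)
open import Data.Empty using (⊥-elim)
open import Function.Base using (_∘_; _$_)
open import Function.Bundles using (_⇔_; mk⇔; Equivalence)
open import Function.Construct.Composition using (_⇔-∘_)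
open import Function.Construct.Symmetry using (⇔-sym)
open import Relation.Binary.Definitions using (tri<; tri≈; tri>)
open import Relation.Binary.PropositionalEquality
open import Relation.Nullary using (¬_; yes; no)
open import Relation.Nullary.Decidable using (dec-true; dec-false)

lt-true : ∀ {a b} → a < b → lt a b ≡ true
lt-true {a} {b} = dec-true (a <? b)

lt-false : ∀ {a b} → b ≤ a → lt a b ≡ false
lt-false {a} {b} b≤a = dec-false (a <? b) (≤⇒≯ b≤a)

record Contains (π σ : List ℕ) : Set where
  constructor occurrence
  field
    ys   : List ℕ
    ys⊆π : ys ⊆ π
    iso  : T (orderIso σ ys)

Avoids : List ℕ → List ℕ → Set
Avoids π σ = ¬ Contains π σ

∈-subseqs⁺ : ∀ {ys xs} → ys ⊆ xs → ys ∈ subseqs xs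
∈-subseqs⁺ []                    = here refl
∈-subseqs⁺ {xs = x ∷ xs} (_ ∷ʳ s) = ∈-++⁺ʳ (map (x ∷_) (subseqs xs)) (∈-subseqs⁺ s)
∈-subseqs⁺ (refl ∷ s)            = ∈-++⁺ˡ (∈-map⁺ (_ ∷_) (∈-subseqs⁺ s))

∈-subseqs⁻ : ∀ {ys} xs → ys ∈ subseqs xs → ys ⊆ xs
∈-subseqs⁻ []       (here refl) = []
∈-subseqs⁻ (x ∷ xs) m with ∈-++⁻ (map (x ∷_) (subseqs xs)) m
... | inj₂ m′ = x ∷ʳ ∈-subseqs⁻ xs m′
... | inj₁ m′ with map∷⁻ m′
...   | ys , m″ , refl = refl ∷ ∈-subseqs⁻ xs m″

contains⇔Contains : ∀ π σ → T (contains π σ) ⇔ Contains π σ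
contains⇔Contains π σ = mk⇔ to from
  where
  to : T (contains π σ) → Contains π σ
  to h with find (Equivalence.from (any⇔ {p = orderIso σ}) h)
  ... | ys , m , iso = occurrence ys (∈-subseqs⁻ π m) iso
  from : Contains π σ → T (contains π σ)
  from (occurrence ys s iso) = Equivalence.to (any⇔ {p = orderIso σ}) (lose (∈-subseqs⁺ s) iso)

contains≡false⇒Avoids : ∀ {π σ} → contains π σ ≡ false → Avoids π σ
contains≡false⇒Avoids {π} {σ} eq occ = subst T eq (Equivalence.from (contains⇔Contains π σ) occ)

avoidsAll⇔All : ∀ S π → avoidsAll S π ≡ true ⇔ All (Avoids π) S
avoidsAll⇔All S π = mk⇔ (to S) (from S)
  where
  to : ∀ S → avoidsAll S π ≡ true → All (Avoids π) S
  to []      _ = []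
  to (σ ∷ S) h with contains π σ in eq
  ... | false = contains≡false⇒Avoids eq ∷ to S h
  from : ∀ S → All (Avoids π) S → avoidsAll S π ≡ true
  from []      []       = refl
  from (σ ∷ S) (a ∷ as) with contains π σ in eq
  ... | true  = ⊥-elim (a (Equivalence.to (contains⇔Contains π σ) (Equivalence.from T-≡ eq)))
  ... | false = from S as

Avoids-⊆ : ∀ {xs ys σ} → xs ⊆ ys → Avoids ys σ → Avoids xs σ
Avoids-⊆ xs⊆ys a (occurrence zs zs⊆xs iso) = a (occurrence zs (⊆-trans zs⊆xs xs⊆ys) iso)

Avoids-++ : ∀ xs {ys σ} → Avoids (xs ++ ys) σ → Avoids ys σ
Avoids-++ xs = Avoids-⊆ (++⁺ˡ xs ⊆-refl)

-- Order-isomorphism, direct sums and shifts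

orderIso-length : ∀ σ ys → T (orderIso σ ys) → length σ ≡ length ys
orderIso-length []      []       _ = refl
orderIso-length (s ∷ σ) (y ∷ ys) h = cong suc (orderIso-length σ ys (proj₂ (Equivalence.to T-∧ h)))

below : List ℕ → List ℕ → Bool
below σ₁ σ₂ = all (λ s → all (lt s) σ₂) σ₁

AllBelow : List ℕ → List ℕ → Set
AllBelow xs ys = All (λ x → All (x <_) ys) xs

sameRel-++ : ∀ s x σ₁ σ₂ xs ys → length σ₁ ≡ length xs →
             sameRel s x (σ₁ ++ σ₂) (xs ++ ys) ≡ sameRel s x σ₁ xs ∧ sameRel s x σ₂ ys
sameRel-++ s x []       σ₂ []       ys _  = refl
sameRel-++ s x (a ∷ σ₁) σ₂ (b ∷ xs) ys eq
  rewrite sameRel-++ s x σ₁ σ₂ xs ys (suc-injective eq)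
  = sym (∧-assoc ((lt s a == lt x b) ∧ (lt a s == lt b x)) (sameRel s x σ₁ xs) (sameRel s x σ₂ ys))

sameRel-above : ∀ s x σ ys → All (x <_) ys → length σ ≡ length ys → sameRel s x σ ys ≡ all (lt s) σ
sameRel-above s x []      []       _          _  = refl
sameRel-above s x (a ∷ σ) (y ∷ ys) (x<y ∷ x<ys) eq
  rewrite lt-true x<y | lt-false (<⇒≤ x<y) | sameRel-above s x σ ys x<ys (suc-injective eq)
  = cong (_∧ all (lt s) σ) (lt-∧-not-lt s a)
  where
  lt-∧-not-lt : ∀ s a → (lt s a == true) ∧ (lt a s == false) ≡ lt s a
  lt-∧-not-lt s a with s <? a
  ... | yes s<a rewrite lt-true s<a | lt-false (<⇒≤ s<a) = refl
  ... | no  s≮a rewrite lt-false (≮⇒≥ s≮a) = refl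

orderIso-++ : ∀ σ₁ σ₂ xs ys → AllBelow xs ys → length σ₁ ≡ length xs → length σ₂ ≡ length ys →
              orderIso (σ₁ ++ σ₂) (xs ++ ys) ≡ below σ₁ σ₂ ∧ (orderIso σ₁ xs ∧ orderIso σ₂ ys)
orderIso-++ []       σ₂ []       ys _              _   _   = refl
orderIso-++ (s ∷ σ₁) σ₂ (x ∷ xs) ys (x<ys ∷ xs<ys) eq₁ eq₂
  rewrite sameRel-++ s x σ₁ σ₂ xs ys (suc-injective eq₁)
        | sameRel-above s x σ₂ ys x<ys eq₂
        | orderIso-++ σ₁ σ₂ xs ys xs<ys (suc-injective eq₁) eq₂
  = rearrange (sameRel s x σ₁ xs) (all (lt s) σ₂) (below σ₁ σ₂) (orderIso σ₁ xs) (orderIso σ₂ ys)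
  where
  open ∨-∧-Solver
  rearrange : ∀ a b c d e → (a ∧ b) ∧ (c ∧ (d ∧ e)) ≡ (b ∧ c) ∧ ((a ∧ d) ∧ e)
  rearrange = solve 5 (λ a b c d e → (a :* b) :* (c :* (d :* e)) := (b :* c) :* ((a :* d) :* e)) refl

⊆-++-split : ∀ (xs : List ℕ) {ys zs} → zs ⊆ xs ++ ys →
             ∃[ zs₁ ] ∃[ zs₂ ] zs ≡ zs₁ ++ zs₂ × zs₁ ⊆ xs × zs₂ ⊆ ys
⊆-++-split []       {zs = zs} s = [] , zs , refl , [] , s
⊆-++-split (x ∷ xs) (_ ∷ʳ s) with ⊆-++-split xs s
... | zs₁ , zs₂ , refl , s₁ , s₂ = zs₁ , zs₂ , refl , x ∷ʳ s₁ , s₂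
⊆-++-split (x ∷ xs) (refl ∷ s) with ⊆-++-split xs s
... | zs₁ , zs₂ , refl , s₁ , s₂ = x ∷ zs₁ , zs₂ , refl , refl ∷ s₁ , s₂

orderIso-++⁻ : ∀ σ zs₁ zs₂ → AllBelow zs₁ zs₂ → T (orderIso σ (zs₁ ++ zs₂)) →
               let i = length zs₁ in
               T (below (take i σ) (drop i σ)) × T (orderIso (take i σ) zs₁) × T (orderIso (drop i σ) zs₂)
orderIso-++⁻ σ zs₁ zs₂ zs₁<zs₂ iso
  with Equivalence.to T-∧ (subst T (orderIso-++ (take i σ) (drop i σ) zs₁ zs₂ zs₁<zs₂ |take| |drop|) iso′)
  where
  i = length zs₁
  |σ| : length σ ≡ i + length zs₂
  |σ| = trans (orderIso-length σ _ iso) (length-++ zs₁)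
  |take| : length (take i σ) ≡ i
  |take| = trans (length-take i σ) (m≤n⇒m⊓n≡m (subst (i ≤_) (sym |σ|) (m≤m+n i _)))
  |drop| : length (drop i σ) ≡ length zs₂
  |drop| = trans (length-drop i σ) (trans (cong (_∸ i) |σ|) (m+n∸m≡n i _))
  iso′ : T (orderIso (take i σ ++ drop i σ) (zs₁ ++ zs₂))
  iso′ = subst (λ τ → T (orderIso τ (zs₁ ++ zs₂))) (sym (take++drop≡id i σ)) iso
... | b , isos = b , Equivalence.to T-∧ isos

Contains-++⁻ : ∀ {xs ys} σ → AllBelow xs ys → Contains (xs ++ ys) σ →
               ∃[ i ] T (below (take i σ) (drop i σ)) × Contains xs (take i σ) × Contains ys (drop i σ)
Contains-++⁻ {xs} σ xs<ys (occurrence zs zs⊆ iso) with ⊆-++-split xs zs⊆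
... | zs₁ , zs₂ , eq , s₁ , s₂ with orderIso-++⁻ σ zs₁ zs₂ zs₁<zs₂ (subst (T ∘ orderIso σ) eq iso)
  where zs₁<zs₂ = All-resp-⊆ s₁ (All.map (All-resp-⊆ s₂) xs<ys)
...   | b , iso₁ , iso₂ = length zs₁ , b , occurrence zs₁ s₁ iso₁ , occurrence zs₂ s₂ iso₂

Contains-++⁺ : ∀ {xs ys σ₁ σ₂} → AllBelow xs ys → T (below σ₁ σ₂) →
               Contains xs σ₁ → Contains ys σ₂ → Contains (xs ++ ys) (σ₁ ++ σ₂)
Contains-++⁺ {σ₁ = σ₁} {σ₂} xs<ys b (occurrence zs₁ s₁ iso₁) (occurrence zs₂ s₂ iso₂) =
  occurrence (zs₁ ++ zs₂) (++⁺ s₁ s₂) $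
  subst T (sym (orderIso-++ σ₁ σ₂ zs₁ zs₂ zs₁<zs₂ (orderIso-length σ₁ zs₁ iso₁)
                                                 (orderIso-length σ₂ zs₂ iso₂)))
          (Equivalence.from T-∧ (b , Equivalence.from T-∧ (iso₁ , iso₂)))
  where zs₁<zs₂ = All-resp-⊆ s₁ (All.map (All-resp-⊆ s₂) xs<ys)

lt-+ : ∀ c a b → lt (a + c) (b + c) ≡ lt a b
lt-+ c a b with a <? b
... | yes a<b = trans (lt-true (+-monoˡ-< c a<b)) (sym (lt-true a<b))
... | no  a≮b = trans (lt-false (+-monoˡ-≤ c (≮⇒≥ a≮b))) (sym (lt-false (≮⇒≥ a≮b)))

sameRel-shiftʳ : ∀ c s y σ ys → sameRel s (y + c) σ (map (_+ c) ys) ≡ sameRel s y σ ys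
sameRel-shiftʳ c s y []      []       = refl
sameRel-shiftʳ c s y []      (_ ∷ _)  = refl
sameRel-shiftʳ c s y (_ ∷ _) []       = refl
sameRel-shiftʳ c s y (a ∷ σ) (b ∷ ys)
  rewrite lt-+ c y b | lt-+ c b y | sameRel-shiftʳ c s y σ ys = refl

orderIso-shiftʳ : ∀ c σ ys → orderIso σ (map (_+ c) ys) ≡ orderIso σ ys
orderIso-shiftʳ c []      []       = refl
orderIso-shiftʳ c []      (_ ∷ _)  = refl
orderIso-shiftʳ c (_ ∷ _) []       = refl
orderIso-shiftʳ c (s ∷ σ) (y ∷ ys)
  rewrite sameRel-shiftʳ c s y σ ys | orderIso-shiftʳ c σ ys = refl

sameRel-shiftˡ : ∀ c s y σ ys → sameRel (s + c) y (map (_+ c) σ) ys ≡ sameRel s y σ ys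
sameRel-shiftˡ c s y []      []       = refl
sameRel-shiftˡ c s y []      (_ ∷ _)  = refl
sameRel-shiftˡ c s y (_ ∷ _) []       = refl
sameRel-shiftˡ c s y (a ∷ σ) (b ∷ ys)
  rewrite lt-+ c s a | lt-+ c a s | sameRel-shiftˡ c s y σ ys = refl

orderIso-shiftˡ : ∀ c σ ys → orderIso (map (_+ c) σ) ys ≡ orderIso σ ys
orderIso-shiftˡ c []      []       = refl
orderIso-shiftˡ c []      (_ ∷ _)  = refl
orderIso-shiftˡ c (_ ∷ _) []       = refl
orderIso-shiftˡ c (s ∷ σ) (y ∷ ys)
  rewrite sameRel-shiftˡ c s y σ ys | orderIso-shiftˡ c σ ys = refl

⊆-map⁻ : ∀ (f : ℕ → ℕ) {ys} xs → ys ⊆ map f xs → ∃[ zs ] zs ⊆ xs × ys ≡ map f zs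
⊆-map⁻ f []       []         = [] , [] , refl
⊆-map⁻ f (x ∷ xs) (_ ∷ʳ s)   with ⊆-map⁻ f xs s
... | zs , zs⊆xs , refl = zs , x ∷ʳ zs⊆xs , refl
⊆-map⁻ f (x ∷ xs) (refl ∷ s) with ⊆-map⁻ f xs s
... | zs , zs⊆xs , refl = x ∷ zs , refl ∷ zs⊆xs , refl

Contains-shift : ∀ c xs σ → Contains (map (_+ c) xs) σ ⇔ Contains xs σ
Contains-shift c xs σ = mk⇔ to from
  where
  to : Contains (map (_+ c) xs) σ → Contains xs σ
  to (occurrence ys ys⊆ iso) with ⊆-map⁻ (_+ c) xs ys⊆
  ... | zs , zs⊆xs , refl = occurrence zs zs⊆xs (subst T (orderIso-shiftʳ c σ zs) iso)
  from : Contains xs σ → Contains (map (_+ c) xs) σ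
  from (occurrence zs zs⊆xs iso) =
    occurrence (map (_+ c) zs) (map⁺ (_+ c) zs⊆xs) (subst T (sym (orderIso-shiftʳ c σ zs)) iso)

Contains534⇔Contains312 : ∀ {π} → Contains π (5 ∷ 3 ∷ 4 ∷ []) ⇔ Contains π (3 ∷ 1 ∷ 2 ∷ [])
Contains534⇔Contains312 = mk⇔ (λ (occurrence ys ys⊆ iso) → occurrence ys ys⊆ (subst T (shift ys) iso))
                              (λ (occurrence ys ys⊆ iso) → occurrence ys ys⊆ (subst T (sym (shift ys)) iso))
  where shift = orderIso-shiftˡ 2 (3 ∷ 1 ∷ 2 ∷ [])

-- Permutations of an interval

PermAbove : ℕ → List ℕ → Set
PermAbove c w = Unique w × All (λ t → c < t × t ≤ length w + c) w

Unique-⊆⇒length≤ : ∀ {xs ys : List ℕ} → Unique xs → (∀ {t} → t ∈ xs → t ∈ ys) → length xs ≤ length ys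
Unique-⊆⇒length≤ {[]}     _            _    = z≤n
Unique-⊆⇒length≤ {x ∷ xs} {ys} (x∉xs ∷ u) xs⊆ys with ∈-∃++ (xs⊆ys (here refl))
... | ys₁ , ys₂ , refl = begin
  suc (length xs)               ≤⟨ s≤s (Unique-⊆⇒length≤ u xs⊆ys₁ys₂) ⟩
  suc (length (ys₁ ++ ys₂))      ≡⟨ cong suc (length-++ ys₁) ⟩
  suc (length ys₁ + length ys₂)  ≡⟨ sym (+-suc (length ys₁) (length ys₂)) ⟩
  length ys₁ + length (x ∷ ys₂)  ≡⟨ sym (length-++ ys₁) ⟩
  length (ys₁ ++ x ∷ ys₂)        ∎
  where
  open ≤-Reasoning
  xs⊆ys₁ys₂ : ∀ {t} → t ∈ xs → t ∈ ys₁ ++ ys₂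
  xs⊆ys₁ys₂ t∈xs with ∈-++⁻ ys₁ (xs⊆ys (there t∈xs))
  ... | inj₁ t∈ys₁         = ∈-++⁺ˡ t∈ys₁
  ... | inj₂ (here refl)   = ⊥-elim (All.lookup x∉xs t∈xs refl)
  ... | inj₂ (there t∈ys₂) = ∈-++⁺ʳ ys₁ t∈ys₂

∈-interval : ∀ {a n t} → a ≤ t → t < n + a → t ∈ map (_+ a) (upTo n)
∈-interval {a} {n} {t} a≤t t<n+a =
  subst (_∈ _) (m∸n+n≡m a≤t)
        (∈-map⁺ (_+ a) (∈-upTo⁺ (subst (t ∸ a <_) (m+n∸n≡m n a) (∸-monoˡ-< t<n+a a≤t))))

least∈ : ∀ {c x w} → PermAbove c (x ∷ w) → suc c ∈ x ∷ w
least∈ {c} {x} {w} (u , range) with suc c ∈? x ∷ w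
... | yes c+1∈ = c+1∈
... | no  c+1∉ = ⊥-elim (1+n≰n (subst (suc n ≤_) |interval| (Unique-⊆⇒length≤ u ⊆interval)))
  where
  n = length w
  interval = map (_+ suc (suc c)) (upTo n)
  |interval| : length interval ≡ n
  |interval| = trans (length-map _ (upTo n)) (length-upTo n)
  ⊆interval : ∀ {t} → t ∈ x ∷ w → t ∈ interval
  ⊆interval {t} t∈ with All.lookup range t∈
  ... | c<t , t≤ = ∈-interval (≤∧≢⇒< c<t λ { refl → c+1∉ t∈ })
                              (≤-trans (s≤s t≤) (≤-reflexive (sym (trans (+-suc n (suc c)) (cong suc (+-suc n c))))))

least∈tail : ∀ {c x w} → PermAbove c (x ∷ w) → x ≢ suc c → suc c ∈ w
least∈tail p x≢c+1 with least∈ p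
... | here c+1≡x = ⊥-elim (x≢c+1 (sym c+1≡x))
... | there c+1∈w = c+1∈w

least<head : ∀ {c x w} → PermAbove c (x ∷ w) → x ≢ suc c → suc c < x
least<head (_ , (c<x , _) ∷ _) x≢c+1 = ≤∧≢⇒< c<x (x≢c+1 ∘ sym)

PermAbove-tail : ∀ {c w} → PermAbove c (suc c ∷ w) → PermAbove (suc c) w
PermAbove-tail {c} {w} (c+1∉w ∷ u , _ ∷ range) = u , All.zipWith shift (c+1∉w , range)
  where
  shift : ∀ {t} → suc c ≢ t × (c < t × t ≤ suc (length w) + c) → suc c < t × t ≤ length w + suc c
  shift {t} (c+1≢t , c<t , t≤) = ≤∧≢⇒< c<t c+1≢t , subst (t ≤_) (sym (+-suc (length w) c)) t≤

PermAbove-swap : ∀ {c x y w} → PermAbove c (x ∷ y ∷ w) → PermAbove c (y ∷ x ∷ w)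
PermAbove-swap ((x≢y ∷ x∉w) ∷ y∉w ∷ u , x∈ ∷ y∈ ∷ range) =
  ((x≢y ∘ sym) ∷ y∉w) ∷ x∉w ∷ u , y∈ ∷ x∈ ∷ range

PermAbove-shift : ∀ c {xs} → PermAbove 0 xs → PermAbove c (map (_+ c) xs)
PermAbove-shift c {xs} (u , range) =
  Unique.map⁺ (+-cancelʳ-≡ c _ _) u ,
  All.map⁺ (All.map (λ {t} (0<t , t≤) → +-monoˡ-< c 0<t , subst (λ k → t + c ≤ k + c) |xs| (+-monoˡ-≤ c (t≤′ t≤)))
                     range)
  where
  |xs| = sym (length-map (_+ c) xs)
  t≤′ : ∀ {t} → t ≤ length xs + 0 → t ≤ length xs
  t≤′ {t} = subst (t ≤_) (+-identityʳ (length xs))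

PermAbove-++ : ∀ {c xs ys} → PermAbove c xs → PermAbove (length xs + c) ys → PermAbove c (xs ++ ys)
PermAbove-++ {c} {xs} {ys} (u₁ , range₁) (u₂ , range₂) =
  Unique.++⁺ u₁ u₂ disjoint ,
  All.++⁺ (All.map (λ (c<t , t≤) → c<t , ≤-trans t≤ (+-monoˡ-≤ c (length-++-≤ˡ xs))) range₁)
          (All.map (λ {t} (above , t≤) → ≤-<-trans (m≤n+m c (length xs)) above , subst (t ≤_) |xs++ys| t≤)
                   range₂)
  where
  |xs++ys| : length ys + (length xs + c) ≡ length (xs ++ ys) + c
  |xs++ys| = trans (sym (+-assoc (length ys) (length xs) c))
                   (cong (_+ c) (trans (+-comm (length ys) (length xs)) (sym (length-++ xs))))
  disjoint : ∀ {t} → ¬ (t ∈ xs × t ∈ ys)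
  disjoint (t∈xs , t∈ys) = <⇒≱ (proj₁ (All.lookup range₂ t∈ys)) (proj₂ (All.lookup range₁ t∈xs))

-- Block sums

data Block : Set where
  one two three : Block

shape : Block → List ℕ
shape one   = 1 ∷ []
shape two   = 2 ∷ 1 ∷ []
shape three = 3 ∷ 1 ∷ 2 ∷ []

size : Block → ℕ
size b = length (shape b)

block : ℕ → Block → List ℕ
block c b = map (_+ c) (shape b)

blockSum : ℕ → List Block → List ℕ
blockSum c []       = []
blockSum c (b ∷ bs) = block c b ++ blockSum (size b + c) bs

totalSize : List Block → ℕ
totalSize bs = sum (map size bs)

block-contains : ∀ b c σ → Contains (block c b) σ ⇔ T (contains (shape b) σ)
block-contains b c σ = ⇔-sym (contains⇔Contains (shape b) σ) ⇔-∘ Contains-shift c (shape b) σ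

shape-PermAbove : ∀ b → PermAbove 0 (shape b)
shape-PermAbove one   = [] ∷ [] , (z<s , ≤-refl) ∷ []
shape-PermAbove two   = ((λ ()) ∷ []) ∷ [] ∷ [] , (z<s , ≤-refl) ∷ (z<s , s≤s z≤n) ∷ []
shape-PermAbove three =
  ((λ ()) ∷ (λ ()) ∷ []) ∷ ((λ ()) ∷ []) ∷ [] ∷ [] ,
  (z<s , ≤-refl) ∷ (z<s , s≤s z≤n) ∷ (z<s , s≤s (s≤s z≤n)) ∷ []

length-block : ∀ b c → length (block c b) ≡ size b
length-block b c = length-map (_+ c) (shape b)

blockSum-PermAbove : ∀ c bs → PermAbove c (blockSum c bs)
blockSum-PermAbove c []       = [] , []
blockSum-PermAbove c (b ∷ bs) =
  PermAbove-++ (PermAbove-shift c (shape-PermAbove b))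
               (subst (λ k → PermAbove (k + c) (blockSum (size b + c) bs)) (sym (length-block b c))
                      (blockSum-PermAbove (size b + c) bs))

block-below-blockSum : ∀ b c bs → AllBelow (block c b) (blockSum (size b + c) bs)
block-below-blockSum b c bs =
  All.map (λ {t} (_ , t≤) → All.map (λ (above , _) → ≤-<-trans (subst (λ k → t ≤ k + c) (length-block b c) t≤)
                                                                above)
                                   (proj₂ (blockSum-PermAbove (size b + c) bs)))
          (proj₂ (PermAbove-shift c (shape-PermAbove b)))

length-blockSum : ∀ c bs → length (blockSum c bs) ≡ totalSize bs
length-blockSum c []       = refl
length-blockSum c (b ∷ bs) =
  trans (length-++ (block c b)) (cong₂ _+_ (length-block b c) (length-blockSum (size b + c) bs))

block-injective : ∀ {c} b b′ {xs ys} → block c b ++ xs ≡ block c b′ ++ ys → b ≡ b′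
block-injective one   one   _ = refl
block-injective two   two   _ = refl
block-injective three three _ = refl
block-injective one   two   e = ⊥-elim (m≢1+n+m _ {0} (∷-injectiveˡ e))
block-injective one   three e = ⊥-elim (m≢1+n+m _ {1} (∷-injectiveˡ e))
block-injective two   three e = ⊥-elim (m≢1+n+m _ {0} (∷-injectiveˡ e))
block-injective two   one   e = ⊥-elim (m≢1+n+m _ {0} (sym (∷-injectiveˡ e)))
block-injective three one   e = ⊥-elim (m≢1+n+m _ {1} (sym (∷-injectiveˡ e)))
block-injective three two   e = ⊥-elim (m≢1+n+m _ {0} (sym (∷-injectiveˡ e)))

blockSum-injective : ∀ c {bs bs′} → blockSum c bs ≡ blockSum c bs′ → bs ≡ bs′
blockSum-injective c {[]}         {[]}          _ = refl
blockSum-injective c {[]}         {one ∷ _}     ()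
blockSum-injective c {[]}         {two ∷ _}     ()
blockSum-injective c {[]}         {three ∷ _}   ()
blockSum-injective c {one ∷ _}    {[]}          ()
blockSum-injective c {two ∷ _}    {[]}          ()
blockSum-injective c {three ∷ _}  {[]}          ()
blockSum-injective c {b ∷ bs}     {b′ ∷ bs′}    e with refl ← block-injective b b′ e =
  cong (b ∷_) (blockSum-injective (size b + c) (++-cancelˡ (block c b) _ _ e))

count<-shift : ∀ c x ys → length (filter (_<? x + c) (map (_+ c) ys)) ≡ length (filter (_<? x) ys)
count<-shift c x []       = refl
count<-shift c x (y ∷ ys) with y <? x
... | yes y<x = begin
  length (filter (_<? x + c) (map (_+ c) (y ∷ ys)))
    ≡⟨ cong length (filter-accept (_<? x + c) (+-monoˡ-< c y<x)) ⟩
  suc (length (filter (_<? x + c) (map (_+ c) ys)))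
    ≡⟨ cong suc (count<-shift c x ys) ⟩
  suc (length (filter (_<? x) ys))
    ≡⟨ cong length (filter-accept (_<? x) y<x) ⟨
  length (filter (_<? x) (y ∷ ys)) ∎
  where open ≡-Reasoning
... | no  y≮x = begin
  length (filter (_<? x + c) (map (_+ c) (y ∷ ys)))
    ≡⟨ cong length (filter-reject (_<? x + c) (y≮x ∘ +-cancelʳ-< c y x)) ⟩
  length (filter (_<? x + c) (map (_+ c) ys))
    ≡⟨ count<-shift c x ys ⟩
  length (filter (_<? x) ys)
    ≡⟨ cong length (filter-reject (_<? x) y≮x) ⟨
  length (filter (_<? x) (y ∷ ys)) ∎
  where open ≡-Reasoning

inv-shift : ∀ c xs → inv (map (_+ c) xs) ≡ inv xs
inv-shift c []       = refl
inv-shift c (x ∷ xs) = cong₂ _+_ (count<-shift c x xs) (inv-shift c xs)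

inv-++ : ∀ {xs ys} → AllBelow xs ys → inv (xs ++ ys) ≡ inv xs + inv ys
inv-++ {[]}                 _              = refl
inv-++ {x ∷ xs} {ys} (x<ys ∷ xs<ys) = begin
  length (filter (_<? x) (xs ++ ys)) + inv (xs ++ ys)
    ≡⟨ cong₂ _+_ (cong length (filter-++ (_<? x) xs ys)) (inv-++ xs<ys) ⟩
  length (filter (_<? x) xs ++ filter (_<? x) ys) + (inv xs + inv ys)
    ≡⟨ cong (λ zs → length (filter (_<? x) xs ++ zs) + (inv xs + inv ys))
            (filter-none (_<? x) (All.map <⇒≯ x<ys)) ⟩
  length (filter (_<? x) xs ++ []) + (inv xs + inv ys)
    ≡⟨ cong (λ zs → length zs + (inv xs + inv ys)) (++-identityʳ (filter (_<? x) xs)) ⟩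
  length (filter (_<? x) xs) + (inv xs + inv ys)
    ≡⟨ +-assoc (length (filter (_<? x) xs)) (inv xs) (inv ys) ⟨
  length (filter (_<? x) xs) + inv xs + inv ys ∎
  where open ≡-Reasoning

inversions : List Block → ℕ
inversions bs = sum (map (inv ∘ shape) bs)

inv-blockSum : ∀ c bs → inv (blockSum c bs) ≡ inversions bs
inv-blockSum c []       = refl
inv-blockSum c (b ∷ bs) = begin
  inv (block c b ++ blockSum (size b + c) bs)
    ≡⟨ inv-++ (block-below-blockSum b c bs) ⟩
  inv (block c b) + inv (blockSum (size b + c) bs)
    ≡⟨ cong₂ _+_ (inv-shift c (shape b)) (inv-blockSum (size b + c) bs) ⟩
  inv (shape b) + inversions bs ∎
  where open ≡-Reasoning

-- σ is not a direct sum σ₁ ⊕ σ₂ of two nonempty patterns.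
SumIndecomposable : List ℕ → Set
SumIndecomposable σ = ∀ i → suc i < length σ → ¬ T (below (take (suc i) σ) (drop (suc i) σ))

Avoids-blockSum : ∀ {σ} → 0 < length σ → SumIndecomposable σ →
                  ∀ c bs → All (λ b → ¬ T (contains (shape b) σ)) bs → Avoids (blockSum c bs) σ
Avoids-blockSum {σ} 0<|σ| _ c [] [] (occurrence [] [] iso) = <⇒≢ 0<|σ| (sym (orderIso-length σ [] iso))
Avoids-blockSum {σ} 0<|σ| indec c (b ∷ bs) (b-avoids ∷ bs-avoid) occ
  with Contains-++⁻ σ (block-below-blockSum b c bs) occ
... | zero  , _     , _    , occ₂ = Avoids-blockSum 0<|σ| indec (size b + c) bs bs-avoid occ₂
... | suc i , cross , occ₁ , _    with suc i <? length σ
...   | yes i<|σ| = indec i i<|σ| cross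
...   | no  i≮|σ| = b-avoids (Equivalence.to (block-contains b c σ)
                               (subst (Contains (block c b)) (take-all (suc i) σ (≮⇒≥ i≮|σ|)) occ₁))

indecomposable-231 : SumIndecomposable (2 ∷ 3 ∷ 1 ∷ [])
indecomposable-231 0 _ ()
indecomposable-231 1 _ ()
indecomposable-231 (suc (suc _)) (s≤s (s≤s (s≤s ())))

indecomposable-321 : SumIndecomposable (3 ∷ 2 ∷ 1 ∷ [])
indecomposable-321 0 _ ()
indecomposable-321 1 _ ()
indecomposable-321 (suc (suc _)) (s≤s (s≤s (s≤s ())))

indecomposable-312 : SumIndecomposable (3 ∷ 1 ∷ 2 ∷ [])
indecomposable-312 0 _ ()
indecomposable-312 1 _ ()
indecomposable-312 (suc (suc _)) (s≤s (s≤s (s≤s ())))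

indecomposable-4123 : SumIndecomposable (4 ∷ 1 ∷ 2 ∷ 3 ∷ [])
indecomposable-4123 0 _ ()
indecomposable-4123 1 _ ()
indecomposable-4123 2 _ ()
indecomposable-4123 (suc (suc (suc _))) (s≤s (s≤s (s≤s (s≤s ()))))

Layered : List Block → Set
Layered = All (_≢ three)

-- Since 21534 = 21 ⊕ 312, no 312-block may follow a block containing 21.
data Admissible : List Block → Set where
  []      : Admissible []
  one∷_   : ∀ {bs} → Admissible bs → Admissible (one ∷ bs)
  two∷_   : ∀ {bs} → Layered bs → Admissible (two ∷ bs)
  three∷_ : ∀ {bs} → Layered bs → Admissible (three ∷ bs)

Layered⇒Avoids312 : ∀ c {bs} → Layered bs → Avoids (blockSum c bs) (3 ∷ 1 ∷ 2 ∷ [])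
Layered⇒Avoids312 c {bs} l = Avoids-blockSum z<s indecomposable-312 c bs (All.map shape-avoids l)
  where
  shape-avoids : ∀ {b} → b ≢ three → ¬ T (contains (shape b) (3 ∷ 1 ∷ 2 ∷ []))
  shape-avoids {one}   _         ()
  shape-avoids {two}   _         ()
  shape-avoids {three} three≢three _ = three≢three refl

-- An occurrence of 21534 meeting both the first block and the rest splits as 21 ⊕ 534, and 534 ≅ 312.
Avoids21534-∷ : ∀ b c bs → Avoids (blockSum (size b + c) bs) (2 ∷ 1 ∷ 5 ∷ 3 ∷ 4 ∷ []) →
                ¬ T (contains (shape b) (2 ∷ 1 ∷ [])) ⊎ Avoids (blockSum (size b + c) bs) (3 ∷ 1 ∷ 2 ∷ []) →
                Avoids (blockSum c (b ∷ bs)) (2 ∷ 1 ∷ 5 ∷ 3 ∷ 4 ∷ [])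
Avoids21534-∷ b c bs rest-avoids no21∨no312 occ
  with Contains-++⁻ (2 ∷ 1 ∷ 5 ∷ 3 ∷ 4 ∷ []) (block-below-blockSum b c bs) occ
... | 0 , _ , _    , occ₂ = rest-avoids occ₂
... | 1 , () , _
... | 2 , _ , occ₁ , occ₂ with no21∨no312
...   | inj₁ no21  = no21 (Equivalence.to (block-contains b c (2 ∷ 1 ∷ [])) occ₁)
...   | inj₂ no312 = no312 (Equivalence.to Contains534⇔Contains312 occ₂)
Avoids21534-∷ b c bs _ _ _ | 3 , () , _
Avoids21534-∷ b c bs _ _ _ | 4 , () , _
Avoids21534-∷ b c bs _ _ _ | i@(suc (suc (suc (suc (suc _))))) , _ , occ₁ , _ =
  shape-avoids b (Equivalence.to (block-contains b c σ)
                   (subst (Contains (block c b)) (take-all i σ (s≤s (s≤s (s≤s (s≤s (s≤s z≤n)))))) occ₁))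
  where
  σ = 2 ∷ 1 ∷ 5 ∷ 3 ∷ 4 ∷ []
  shape-avoids : ∀ b → ¬ T (contains (shape b) σ)
  shape-avoids one   ()
  shape-avoids two   ()
  shape-avoids three ()

Layered⇒Avoids21534 : ∀ c {bs} → Layered bs → Avoids (blockSum c bs) (2 ∷ 1 ∷ 5 ∷ 3 ∷ 4 ∷ [])
Layered⇒Avoids21534 c []                             (occurrence [] [] ())
Layered⇒Avoids21534 c {one ∷ bs}   (_ ∷ l)           =
  Avoids21534-∷ one c bs (Layered⇒Avoids21534 (suc c) l) (inj₁ λ ())
Layered⇒Avoids21534 c {two ∷ bs}   (_ ∷ l)           =
  Avoids21534-∷ two c bs (Layered⇒Avoids21534 (2 + c) l) (inj₂ (Layered⇒Avoids312 (2 + c) l))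
Layered⇒Avoids21534 c {three ∷ bs} (three≢three ∷ _) = ⊥-elim (three≢three refl)

Admissible⇒Avoids21534 : ∀ c {bs} → Admissible bs → Avoids (blockSum c bs) (2 ∷ 1 ∷ 5 ∷ 3 ∷ 4 ∷ [])
Admissible⇒Avoids21534 c []                      (occurrence [] [] ())
Admissible⇒Avoids21534 c {one ∷ bs}   (one∷ a)   =
  Avoids21534-∷ one c bs (Admissible⇒Avoids21534 (suc c) a) (inj₁ λ ())
Admissible⇒Avoids21534 c {two ∷ bs}   (two∷ l)   =
  Avoids21534-∷ two c bs (Layered⇒Avoids21534 (2 + c) l) (inj₂ (Layered⇒Avoids312 (2 + c) l))
Admissible⇒Avoids21534 c {three ∷ bs} (three∷ l) =
  Avoids21534-∷ three c bs (Layered⇒Avoids21534 (3 + c) l) (inj₂ (Layered⇒Avoids312 (3 + c) l))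

Admissible⇒AvoidsA₂ : ∀ c {bs} → Admissible bs → All (Avoids (blockSum c bs)) A₂
Admissible⇒AvoidsA₂ c {bs} a =
  Avoids-blockSum z<s indecomposable-231 c bs (All.tabulate λ { {one} _ () ; {two} _ () ; {three} _ () }) ∷
  Avoids-blockSum z<s indecomposable-321 c bs (All.tabulate λ { {one} _ () ; {two} _ () ; {three} _ () }) ∷
  Avoids-blockSum z<s indecomposable-4123 c bs (All.tabulate λ { {one} _ () ; {two} _ () ; {three} _ () }) ∷
  Admissible⇒Avoids21534 c a ∷ []

Avoids312⇒Layered : ∀ c bs → Avoids (blockSum c bs) (3 ∷ 1 ∷ 2 ∷ []) → Layered bs
Avoids312⇒Layered c []       _ = []
Avoids312⇒Layered c (b ∷ bs) a = b≢three ∷ Avoids312⇒Layered (size b + c) bs (Avoids-++ (block c b) a)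
  where
  b≢three : b ≢ three
  b≢three refl = Avoids-⊆ (++⁺ʳ (blockSum (3 + c) bs) ⊆-refl) a (Equivalence.from (block-contains three c _) _)

Contains21534-∷ : ∀ b c bs → T (contains (shape b) (2 ∷ 1 ∷ [])) →
                  Contains (blockSum (size b + c) bs) (3 ∷ 1 ∷ 2 ∷ []) →
                  Contains (blockSum c (b ∷ bs)) (2 ∷ 1 ∷ 5 ∷ 3 ∷ 4 ∷ [])
Contains21534-∷ b c bs b∋21 occ =
  Contains-++⁺ {σ₁ = 2 ∷ 1 ∷ []} (block-below-blockSum b c bs) _ (Equivalence.from (block-contains b c _) b∋21)
               (Equivalence.from Contains534⇔Contains312 occ)

Avoids21534⇒Admissible : ∀ c bs → Avoids (blockSum c bs) (2 ∷ 1 ∷ 5 ∷ 3 ∷ 4 ∷ []) → Admissible bs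
Avoids21534⇒Admissible c []           _ = []
Avoids21534⇒Admissible c (one ∷ bs)   a = one∷ Avoids21534⇒Admissible (suc c) bs (Avoids-++ (block c one) a)
Avoids21534⇒Admissible c (two ∷ bs)   a = two∷ Avoids312⇒Layered (2 + c) bs (a ∘ Contains21534-∷ two c bs _)
Avoids21534⇒Admissible c (three ∷ bs) a = three∷ Avoids312⇒Layered (3 + c) bs (a ∘ Contains21534-∷ three c bs _)

-- Every A₂-avoiding permutation is a block sum

iso231 : ∀ {x y z} → z < x → x < y → T (orderIso (2 ∷ 3 ∷ 1 ∷ []) (x ∷ y ∷ z ∷ []))
iso231 z<x x<y
  rewrite lt-true x<y | lt-false (<⇒≤ x<y) | lt-true z<x | lt-false (<⇒≤ z<x)
        | lt-true (<-trans z<x x<y) | lt-false (<⇒≤ (<-trans z<x x<y)) = _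

iso321 : ∀ {x y z} → z < y → y < x → T (orderIso (3 ∷ 2 ∷ 1 ∷ []) (x ∷ y ∷ z ∷ []))
iso321 z<y y<x
  rewrite lt-true y<x | lt-false (<⇒≤ y<x) | lt-true z<y | lt-false (<⇒≤ z<y)
        | lt-true (<-trans z<y y<x) | lt-false (<⇒≤ (<-trans z<y y<x)) = _

iso4123 : ∀ {x a b d} → a < b → b < d → d < x → T (orderIso (4 ∷ 1 ∷ 2 ∷ 3 ∷ []) (x ∷ a ∷ b ∷ d ∷ []))
iso4123 a<b b<d d<x
  rewrite lt-true a<b | lt-false (<⇒≤ a<b) | lt-true b<d | lt-false (<⇒≤ b<d)
        | lt-true d<x | lt-false (<⇒≤ d<x)
        | lt-true (<-trans a<b b<d) | lt-false (<⇒≤ (<-trans a<b b<d))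
        | lt-true (<-trans b<d d<x) | lt-false (<⇒≤ (<-trans b<d d<x))
        | lt-true (<-trans a<b (<-trans b<d d<x)) | lt-false (<⇒≤ (<-trans a<b (<-trans b<d d<x))) = _

second<later : ∀ {x y m w} → Unique (x ∷ y ∷ w) →
              Avoids (x ∷ y ∷ w) (2 ∷ 3 ∷ 1 ∷ []) → Avoids (x ∷ y ∷ w) (3 ∷ 2 ∷ 1 ∷ []) →
              m ∈ w → m < x → y < m
second<later {x} {y} {m} ((x≢y ∷ _) ∷ y∉w ∷ _) a231 a321 m∈w m<x with <-cmp y m
... | tri< y<m _ _ = y<m
... | tri≈ _ refl _ = ⊥-elim (All.lookup y∉w m∈w refl)
... | tri> _ _ m<y with <-cmp x y
...   | tri< x<y _ _  = ⊥-elim (a231 (occurrence (x ∷ y ∷ m ∷ []) xym⊆ (iso231 m<x x<y)))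
  where xym⊆ = refl ∷ refl ∷ from∈ m∈w
...   | tri≈ _ x≡y _  = ⊥-elim (x≢y x≡y)
...   | tri> _ _ y<x  = ⊥-elim (a321 (occurrence (x ∷ y ∷ m ∷ []) xym⊆ (iso321 m<y y<x)))
  where xym⊆ = refl ∷ refl ∷ from∈ m∈w

second≡least : ∀ {c x w} → PermAbove c (x ∷ w) → All (Avoids (x ∷ w)) A₂ → x ≢ suc c →
                ∃[ w′ ] w ≡ suc c ∷ w′ × PermAbove (suc c) (x ∷ w′) × All (Avoids (x ∷ w′)) A₂
second≡least {w = []} p _ x≢c+1 with () ← least∈tail p x≢c+1
second≡least {c} {x} {y ∷ w′} p a@(a231 ∷ a321 ∷ _) x≢c+1 with least∈tail p x≢c+1
... | here refl =
  w′ , refl , PermAbove-tail (PermAbove-swap p) , All.map (Avoids-⊆ (refl ∷ (suc c ∷ʳ ⊆-refl))) a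
... | there c+1∈w′ = ⊥-elim (<⇒≱ c<y (≤-pred y<c+1))
  where
  c<y = proj₁ (All.lookup (proj₂ p) (there (here refl)))
  y<c+1 = second<later (proj₁ p) a231 a321 c+1∈w′ (least<head p x≢c+1)

data LeadingBlock (c : ℕ) : List ℕ → Set where
  one◂   : ∀ w → LeadingBlock c (block c one ++ w)
  two◂   : ∀ w → LeadingBlock c (block c two ++ w)
  three◂ : ∀ w → LeadingBlock c (block c three ++ w)

-- By second≡least, unless the head x is c+1 the next entry is c+1; deleting it, unless x is c+2
-- the next entry is c+2, and so on. If x exceeded c+3, then x, c+1, c+2, c+3 would form a 4123.
leadingBlock : ∀ {c x w} → PermAbove c (x ∷ w) → All (Avoids (x ∷ w)) A₂ → LeadingBlock c (x ∷ w)
leadingBlock {c} {x} {w} p a@(_ ∷ _ ∷ a4123 ∷ _) with x ≟ suc c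
... | yes refl = one◂ w
... | no x≢c+1 with second≡least p a x≢c+1
...   | w′ , refl , p′ , a′ with x ≟ 2 + c
...     | yes refl = two◂ w′
...     | no x≢c+2 with second≡least p′ a′ x≢c+2
...       | w″ , refl , p″ , _ with x ≟ 3 + c
...         | yes refl = three◂ w″
...         | no x≢c+3 = ⊥-elim (a4123 (occurrence (x ∷ 1 + c ∷ 2 + c ∷ 3 + c ∷ [])
                                   (refl ∷ refl ∷ refl ∷ from∈ (least∈tail p″ x≢c+3))
                                   (iso4123 ≤-refl ≤-refl (least<head p″ x≢c+3))))

PermAbove-dropBlock : ∀ b {c w} → PermAbove c (block c b ++ w) → PermAbove (size b + c) w
PermAbove-dropBlock one   = PermAbove-tail
PermAbove-dropBlock two   = PermAbove-tail ∘ PermAbove-tail ∘ PermAbove-swap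
PermAbove-dropBlock three =
  PermAbove-tail ∘ PermAbove-tail ∘ PermAbove-swap ∘ PermAbove-tail ∘ PermAbove-swap

blockSum-∷ : ∀ b {c w} → ∃[ bs ] w ≡ blockSum (size b + c) bs → ∃[ bs ] block c b ++ w ≡ blockSum c bs
blockSum-∷ b (bs , refl) = b ∷ bs , refl

blockDecomposition : ∀ {c} w → PermAbove c w → All (Avoids w) A₂ → ∃[ bs ] w ≡ blockSum c bs
blockDecomposition []      _ _ = [] , refl
blockDecomposition (x ∷ w) p a with leadingBlock p a
... | one◂ rest =
  blockSum-∷ one (blockDecomposition rest (PermAbove-dropBlock one p) (All.map (Avoids-++ (block _ one)) a))
... | two◂ rest =
  blockSum-∷ two (blockDecomposition rest (PermAbove-dropBlock two p) (All.map (Avoids-++ (block _ two)) a))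
... | three◂ rest =
  blockSum-∷ three (blockDecomposition rest (PermAbove-dropBlock three p) (All.map (Avoids-++ (block _ three)) a))

-- Counting

module _ {A : Set} where

  Unique-map∷ : ∀ (a : A) {L} → Unique L → Unique (map (a ∷_) L)
  Unique-map∷ a = Unique.map⁺ ∷-injectiveʳ

  map∷-disjoint : ∀ {a a′ : A} {L M} → a ≢ a′ → Disjoint (map (a ∷_) L) (map (a′ ∷_) M)
  map∷-disjoint a≢a′ (v∈aL , v∈a′M) with map∷⁻ v∈aL
  ... | _ , _ , refl = a≢a′ (proj₁ (map∷-decomp∈ v∈a′M))

  length-map∷-++ : ∀ (a a′ : A) (L M : List (List A)) →
                   length (map (a ∷_) L ++ map (a′ ∷_) M) ≡ length L + length M
  length-map∷-++ a a′ L M =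
    trans (length-++ (map (a ∷_) L)) (cong₂ _+_ (length-map (a ∷_) L) (length-map (a′ ∷_) M))

  length-unique-⇔ : ∀ {xs ys : List A} → Unique xs → Unique ys → (∀ {x} → x ∈ xs ⇔ x ∈ ys) →
                    length xs ≡ length ys
  length-unique-⇔ u v xs⇔ys = ↭-length (∼bag⇒↭ (unique∧set⇒bag u v xs⇔ys))

∈-lists⁻ : ∀ n xs {w} → w ∈ lists n xs → length w ≡ n × All (_∈ xs) w
∈-lists⁻ zero    xs (here refl) = refl , []
∈-lists⁻ (suc n) xs m with find (∈-concatMap⁻ (λ x → map (x ∷_) (lists n xs)) {xs = xs} m)
... | x , x∈xs , m′ with map∷⁻ m′
...   | w , w∈ , refl with ∈-lists⁻ n xs w∈
...     | refl , w⊆xs = refl , x∈xs ∷ w⊆xs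

∈-lists⁺ : ∀ {xs} w → All (_∈ xs) w → w ∈ lists (length w) xs
∈-lists⁺ []      []              = here refl
∈-lists⁺ (x ∷ w) (x∈xs ∷ w⊆xs) =
  ∈-concatMap⁺ (λ y → map (y ∷_) (lists (length w) _)) (lose x∈xs (∈-map⁺ (x ∷_) (∈-lists⁺ w w⊆xs)))

Unique-lists : ∀ n {xs} → Unique xs → Unique (lists n xs)
Unique-lists zero    _ = [] ∷ []
Unique-lists (suc n) u =
  Unique.concat⁺ (All.map⁺ (All.tabulate λ {x} _ → Unique-map∷ x (Unique-lists n u)))
                 (AllPairs.map⁺ (AllPairs.map map∷-disjoint u))

∈-perms⁻ : ∀ n {w} → w ∈ perms n → PermAbove 0 w × length w ≡ n
∈-perms⁻ n m with ∈-filter⁻ (λ w → unique? w) m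
... | m′ , u with ∈-lists⁻ n _ m′
...   | refl , w⊆alphabet = (u , All.map range w⊆alphabet) , refl
  where
  range : ∀ {t} → t ∈ map suc (upTo n) → 0 < t × t ≤ n + 0
  range t∈ with ∈-map⁻ suc t∈
  ... | i , i∈ , refl = z<s , subst (suc i ≤_) (sym (+-identityʳ n)) (∈-upTo⁻ i∈)

∈-perms⁺ : ∀ {w} → PermAbove 0 w → w ∈ perms (length w)
∈-perms⁺ {w} (u , range) = ∈-filter⁺ (λ w → unique? w) (∈-lists⁺ w (All.map alphabet range)) u
  where
  alphabet : ∀ {t} → 0 < t × t ≤ length w + 0 → t ∈ map suc (upTo (length w))
  alphabet {suc i} (_ , t≤) = ∈-map⁺ suc (∈-upTo⁺ (subst (suc i ≤_) (+-identityʳ _) t≤))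

Unique-perms : ∀ n → Unique (perms n)
Unique-perms n = Unique.filter⁺ (λ w → unique? w) (Unique-lists n (Unique.map⁺ suc-injective (Unique.upTo⁺ n)))

-- layered n k lists the block words without three of total size n with k inversions;
-- afterTwo n k and afterThree n k list the words that may follow a first block two or three
-- in a word of total size n + 1 with k inversions.
mutual
  layered : ℕ → ℕ → List (List Block)
  layered zero    zero    = [] ∷ []
  layered zero    (suc k) = []
  layered (suc n) k       = map (one ∷_) (layered n k) ++ map (two ∷_) (afterTwo n k)

  afterTwo : ℕ → ℕ → List (List Block)
  afterTwo n       zero    = []
  afterTwo zero    (suc k) = []
  afterTwo (suc n) (suc k) = layered n k

afterThree : ℕ → ℕ → List (List Block)
afterThree (suc (suc n)) (suc (suc k)) = layered n k
afterThree _             _             = []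

admissible : ℕ → ℕ → List (List Block)
admissible zero    zero    = [] ∷ []
admissible zero    (suc k) = []
admissible (suc n) k       =
  map (one ∷_) (admissible n k) ++ map (two ∷_) (afterTwo n k) ++ map (three ∷_) (afterThree n k)

∈-layered⁻ : ∀ n k {bs} → bs ∈ layered n k → Layered bs × totalSize bs ≡ n × inversions bs ≡ k
∈-layered⁻ zero    zero (here refl) = [] , refl , refl
∈-layered⁻ (suc n) k    m with ∈-++⁻ (map (one ∷_) (layered n k)) m
... | inj₁ m₁ with map∷⁻ m₁
...   | bs , m′ , refl with ∈-layered⁻ n k m′
...     | l , refl , refl = (λ ()) ∷ l , refl , refl
∈-layered⁻ (suc (suc n)) (suc k) m | inj₂ m₂ with map∷⁻ m₂
...   | bs , m′ , refl with ∈-layered⁻ n k m′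
...     | l , refl , refl = (λ ()) ∷ l , refl , refl

∈-layered⁺ : ∀ {bs} → Layered bs → bs ∈ layered (totalSize bs) (inversions bs)
∈-layered⁺ []                          = here refl
∈-layered⁺ {one ∷ bs}   (_ ∷ l)           = ∈-++⁺ˡ (∈-map⁺ (one ∷_) (∈-layered⁺ l))
∈-layered⁺ {two ∷ bs}   (_ ∷ l)           =
  ∈-++⁺ʳ (map (one ∷_) (layered (suc (totalSize bs)) (suc (inversions bs))))
         (∈-map⁺ (two ∷_) (∈-layered⁺ l))
∈-layered⁺ {three ∷ bs} (three≢three ∷ _) = ⊥-elim (three≢three refl)

∈-admissible⁻ : ∀ n k {bs} → bs ∈ admissible n k → Admissible bs × totalSize bs ≡ n × inversions bs ≡ k
∈-admissible⁻ zero    zero (here refl) = [] , refl , refl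
∈-admissible⁻ (suc n) k    m with ∈-++⁻ (map (one ∷_) (admissible n k)) m
... | inj₁ m₁ with map∷⁻ m₁
...   | bs , m′ , refl with ∈-admissible⁻ n k m′
...     | a , refl , refl = one∷ a , refl , refl
∈-admissible⁻ (suc n) k m | inj₂ m₂ with ∈-++⁻ (map (two ∷_) (afterTwo n k)) m₂
∈-admissible⁻ (suc (suc n)) (suc k) m | inj₂ m₂ | inj₁ m₃ with map∷⁻ m₃
...   | bs , m′ , refl with ∈-layered⁻ n k m′
...     | l , refl , refl = two∷ l , refl , refl
∈-admissible⁻ (suc (suc (suc n))) (suc (suc k)) m | inj₂ m₂ | inj₂ m₃ with map∷⁻ m₃
...   | bs , m′ , refl with ∈-layered⁻ n k m′
...     | l , refl , refl = three∷ l , refl , refl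

∈-admissible⁺ : ∀ {bs} → Admissible bs → bs ∈ admissible (totalSize bs) (inversions bs)
∈-admissible⁺ []                      = here refl
∈-admissible⁺ (one∷ a)                = ∈-++⁺ˡ (∈-map⁺ (one ∷_) (∈-admissible⁺ a))
∈-admissible⁺ {two ∷ bs}   (two∷ l)   =
  ∈-++⁺ʳ (map (one ∷_) (admissible (suc (totalSize bs)) (suc (inversions bs))))
         (∈-++⁺ˡ (∈-map⁺ (two ∷_) (∈-layered⁺ l)))
∈-admissible⁺ {three ∷ bs} (three∷ l) =
  ∈-++⁺ʳ (map (one ∷_) (admissible (suc (suc (totalSize bs))) (suc (suc (inversions bs)))))
         (∈-++⁺ʳ (map (two ∷_) (afterTwo (suc (suc (totalSize bs))) (suc (suc (inversions bs)))))
                 (∈-map⁺ (three ∷_) (∈-layered⁺ l)))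

mutual
  Unique-layered : ∀ n k → Unique (layered n k)
  Unique-layered zero    zero    = [] ∷ []
  Unique-layered zero    (suc k) = []
  Unique-layered (suc n) k       =
    Unique.++⁺ (Unique-map∷ one (Unique-layered n k)) (Unique-map∷ two (Unique-afterTwo n k)) (map∷-disjoint λ ())

  Unique-afterTwo : ∀ n k → Unique (afterTwo n k)
  Unique-afterTwo n       zero    = []
  Unique-afterTwo zero    (suc k) = []
  Unique-afterTwo (suc n) (suc k) = Unique-layered n k

Unique-afterThree : ∀ n k → Unique (afterThree n k)
Unique-afterThree (suc (suc n)) (suc (suc k)) = Unique-layered n k
Unique-afterThree zero          _             = []
Unique-afterThree (suc zero)    _             = []
Unique-afterThree (suc (suc n)) zero          = []
Unique-afterThree (suc (suc n)) (suc zero)    = []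

Unique-admissible : ∀ n k → Unique (admissible n k)
Unique-admissible zero    zero    = [] ∷ []
Unique-admissible zero    (suc k) = []
Unique-admissible (suc n) k       =
  Unique.++⁺ (Unique-map∷ one (Unique-admissible n k))
             (Unique.++⁺ (Unique-map∷ two (Unique-afterTwo n k)) (Unique-map∷ three (Unique-afterThree n k))
                         (map∷-disjoint λ ()))
             λ (v∈one , v∈two∨three) → [ (λ v∈two → map∷-disjoint (λ ()) (v∈one , v∈two))
                                        , (λ v∈three → map∷-disjoint (λ ()) (v∈one , v∈three)) ]′
                                        (∈-++⁻ (map (two ∷_) (afterTwo n k)) v∈two∨three)

∈-counted⁻ : ∀ n k {π} → π ∈ filter (λ π → inv π ≟ k) (Av n A₂) →
             PermAbove 0 π × length π ≡ n × All (Avoids π) A₂ × inv π ≡ k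
∈-counted⁻ n k {π} m with ∈-filter⁻ (λ π → inv π ≟ k) m
... | m′ , inv≡k with ∈-filter⁻ (λ π → avoidsAll A₂ π Bool.≟ true) m′
...   | m″ , avoids with ∈-perms⁻ n m″
...     | p , |π| = p , |π| , Equivalence.to (avoidsAll⇔All A₂ π) avoids , inv≡k

∈-counted⁺ : ∀ {k π} → PermAbove 0 π → All (Avoids π) A₂ → inv π ≡ k →
             π ∈ filter (λ π → inv π ≟ k) (Av (length π) A₂)
∈-counted⁺ {k} {π} p a inv≡k =
  ∈-filter⁺ (λ π → inv π ≟ k)
            (∈-filter⁺ (λ π → avoidsAll A₂ π Bool.≟ true) (∈-perms⁺ p)
                       (Equivalence.from (avoidsAll⇔All A₂ π) a))
            inv≡k

counted⇔blockSums : ∀ n k {π} →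
                    π ∈ filter (λ π → inv π ≟ k) (Av n A₂) ⇔ π ∈ map (blockSum 0) (admissible n k)
counted⇔blockSums n k = mk⇔ to from
  where
  to : ∀ {π} → π ∈ filter (λ π → inv π ≟ k) (Av n A₂) → π ∈ map (blockSum 0) (admissible n k)
  to m with ∈-counted⁻ n k m
  ... | p , |π| , a@(_ ∷ _ ∷ _ ∷ a21534 ∷ []) , inv≡k with blockDecomposition _ p a
  ...   | bs , refl = ∈-map⁺ (blockSum 0) $
    subst₂ (λ n k → bs ∈ admissible n k)
           (trans (sym (length-blockSum 0 bs)) |π|) (trans (sym (inv-blockSum 0 bs)) inv≡k)
           (∈-admissible⁺ (Avoids21534⇒Admissible 0 bs a21534))
  from : ∀ {π} → π ∈ map (blockSum 0) (admissible n k) → π ∈ filter (λ π → inv π ≟ k) (Av n A₂)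
  from m with ∈-map⁻ (blockSum 0) m
  ... | bs , bs∈ , refl with ∈-admissible⁻ n k bs∈
  ...   | a , refl , refl =
    subst (λ n → blockSum 0 bs ∈ filter (λ π → inv π ≟ inversions bs) (Av n A₂)) (length-blockSum 0 bs)
          (∈-counted⁺ (blockSum-PermAbove 0 bs) (Admissible⇒AvoidsA₂ 0 a) (inv-blockSum 0 bs))

countInv-A₂ : ∀ n k → countInv A₂ n k ≡ length (admissible n k)
countInv-A₂ n k = begin
  countInv A₂ n k
    ≡⟨ length-unique-⇔ unique-counted unique-blockSums (counted⇔blockSums n k) ⟩
  length (map (blockSum 0) (admissible n k))
    ≡⟨ length-map (blockSum 0) (admissible n k) ⟩
  length (admissible n k) ∎
  where
  open ≡-Reasoning
  unique-counted : Unique (filter (λ π → inv π ≟ k) (Av n A₂))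
  unique-counted = Unique.filter⁺ _ (Unique.filter⁺ _ (Unique-perms n))
  unique-blockSums : Unique (map (blockSum 0) (admissible n k))
  unique-blockSums = Unique.map⁺ (blockSum-injective 0) (Unique-admissible n k)

-- For k > n both sides are 0, thanks to truncated subtraction.
∸-pascal : ∀ n k → (n ∸ k) C k + (n ∸ k) C suc k ≡ (suc n ∸ k) C suc k
∸-pascal n k with k ≤? n
... | yes k≤n = trans (nCk+nC[k+1]≡[n+1]C[k+1] (n ∸ k) k) (cong (_C suc k) (sym (+-∸-assoc 1 k≤n)))
... | no  k≰n rewrite m≤n⇒m∸n≡0 (≰⇒≥ k≰n) | m≤n⇒m∸n≡0 (≰⇒> k≰n) =
  cong (_+ 0) (k>n⇒nCk≡0 (≤-trans (s≤s z≤n) (≰⇒> k≰n)))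

length-layered : ∀ n k → length (layered n k) ≡ (n ∸ k) C k
length-layered zero          zero    = refl
length-layered zero          (suc k) = refl
length-layered (suc n)       zero    =
  trans (length-map∷-++ one two (layered n 0) []) (trans (+-identityʳ _) (length-layered n zero))
length-layered (suc zero)    (suc k) rewrite 0∸n≡0 k = refl
length-layered (suc (suc n)) (suc k) = begin
  length (map (one ∷_) (layered (suc n) (suc k)) ++ map (two ∷_) (layered n k))
    ≡⟨ length-map∷-++ one two (layered (suc n) (suc k)) (layered n k) ⟩
  length (layered (suc n) (suc k)) + length (layered n k)
    ≡⟨ cong₂ _+_ (length-layered (suc n) (suc k)) (length-layered n k) ⟩
  (n ∸ k) C suc k + (n ∸ k) C k
    ≡⟨ +-comm ((n ∸ k) C suc k) _ ⟩
  (n ∸ k) C k + (n ∸ k) C suc k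
    ≡⟨ ∸-pascal n k ⟩
  (suc n ∸ k) C suc k ∎
  where open ≡-Reasoning

length-admissible-suc : ∀ n k → length (admissible (suc n) k) ≡
                        length (admissible n k) + (length (afterTwo n k) + length (afterThree n k))
length-admissible-suc n k =
  trans (length-++ (map (one ∷_) (admissible n k)))
        (cong₂ _+_ (length-map (one ∷_) (admissible n k)) (length-map∷-++ two three (afterTwo n k) (afterThree n k)))

length-admissible : ∀ n k → length (admissible n (2 + k)) ≡ (suc n ∸ (2 + k)) C (2 + k)
length-admissible zero                k = refl
length-admissible (suc zero)          k rewrite 0∸n≡0 k = refl
length-admissible (suc (suc zero))    k = sym (k>n⇒nCk≡0 (s≤s (≤-trans (m∸n≤m 1 k) (s≤s z≤n))))
length-admissible (suc (suc (suc m))) k = begin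
  length (admissible (3 + m) (2 + k))
    ≡⟨ length-admissible-suc (2 + m) (2 + k) ⟩
  length (admissible (2 + m) (2 + k)) + (length (layered (suc m) (suc k)) + length (layered m k))
    ≡⟨ cong₂ _+_ (length-admissible (suc (suc m)) k)
                 (cong₂ _+_ (length-layered (suc m) (suc k)) (length-layered m k)) ⟩
  (suc m ∸ k) C (2 + k) + ((m ∸ k) C suc k + (m ∸ k) C k)
    ≡⟨ cong ((suc m ∸ k) C (2 + k) +_) (trans (+-comm ((m ∸ k) C suc k) _) (∸-pascal m k)) ⟩
  (suc m ∸ k) C (2 + k) + (suc m ∸ k) C suc k
    ≡⟨ +-comm ((suc m ∸ k) C (2 + k)) _ ⟩
  (suc m ∸ k) C suc k + (suc m ∸ k) C (2 + k)
    ≡⟨ ∸-pascal (2 + m) (suc k) ⟩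
  (2 + m ∸ k) C (2 + k) ∎
  where open ≡-Reasoning

hockey-stick : ∀ j M → sum (map (λ ℓ → (ℓ ∸ j) C j) (filter (j ≤?_) (upTo M))) ≡ (M ∸ j) C suc j
hockey-stick j zero    rewrite 0∸n≡0 j = refl
hockey-stick j (suc M) = begin
  sum (map f (filter (j ≤?_) (upTo (suc M))))
    ≡⟨ cong (sum ∘ map f ∘ filter (j ≤?_)) (upTo-∷ʳ M) ⟨
  sum (map f (filter (j ≤?_) (upTo M ++ M ∷ [])))
    ≡⟨ cong (sum ∘ map f) (filter-++ (j ≤?_) (upTo M) (M ∷ [])) ⟩
  sum (map f (filter (j ≤?_) (upTo M) ++ filter (j ≤?_) (M ∷ [])))
    ≡⟨ cong sum (map-++ f (filter (j ≤?_) (upTo M)) _) ⟩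
  sum (map f (filter (j ≤?_) (upTo M)) ++ map f (filter (j ≤?_) (M ∷ [])))
    ≡⟨ sum-++ (map f (filter (j ≤?_) (upTo M))) _ ⟩
  sum (map f (filter (j ≤?_) (upTo M))) + sum (map f (filter (j ≤?_) (M ∷ [])))
    ≡⟨ cong₂ _+_ (hockey-stick j M) last-term ⟩
  (M ∸ j) C suc j + (M ∸ j) C j
    ≡⟨ +-comm ((M ∸ j) C suc j) _ ⟩
  (M ∸ j) C j + (M ∸ j) C suc j
    ≡⟨ ∸-pascal M j ⟩
  (suc M ∸ j) C suc j ∎
  where
  open ≡-Reasoning
  f : ℕ → ℕ
  f ℓ = (ℓ ∸ j) C j
  last-term : sum (map f (filter (j ≤?_) (M ∷ []))) ≡ f M
  last-term with j ≤? M
  ... | yes j≤M = trans (cong (sum ∘ map f) (filter-accept (j ≤?_) j≤M)) (+-identityʳ (f M))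
  ... | no  j≰M = trans (cong (sum ∘ map f) (filter-reject (j ≤?_) j≰M))
                        (sym (trans (cong (_C j) (m≤n⇒m∸n≡0 (≰⇒≥ j≰M)))
                                    (k>n⇒nCk≡0 (≤-trans (s≤s z≤n) (≰⇒> j≰M)))))

theorem3p3 : ∀ (n k : ℕ) → 1 ≤ n → 2 ≤ k →
    (countInv A₂ n k ≡ (n ∸ k) C k
        + sum (map (λ ℓ → (ℓ ∸ (k ∸ 2)) C (k ∸ 2)) (filter (λ ℓ → k ∸ 2 ≤? ℓ) (upTo (n ∸ 2)))))
  × ((n ∸ k) C k + sum (map (λ ℓ → (ℓ ∸ (k ∸ 2)) C (k ∸ 2)) (filter (λ ℓ → k ∸ 2 ≤? ℓ) (upTo (n ∸ 2))))
        ≡ (n ∸ k) C k + (n ∸ k) C (k ∸ 1))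
  × ((n ∸ k) C k + (n ∸ k) C (k ∸ 1) ≡ (suc n ∸ k) C k)
theorem3p3 (suc m) (suc (suc j)) _ _ = counted , summed , pascal
  where
  n = suc m
  k = 2 + j
  hockey : sum (map (λ ℓ → (ℓ ∸ j) C j) (filter (j ≤?_) (upTo (n ∸ 2)))) ≡ (n ∸ k) C suc j
  hockey = trans (hockey-stick j (n ∸ 2)) (cong (_C suc j) (∸-+-assoc n 2 j))
  summed = cong ((n ∸ k) C k +_) hockey
  pascal : (n ∸ k) C k + (n ∸ k) C suc j ≡ (suc n ∸ k) C k
  pascal = trans (+-comm ((n ∸ k) C k) _) (∸-pascal m (suc j))
  counted : countInv A₂ n k ≡ (n ∸ k) C k + sum (map (λ ℓ → (ℓ ∸ j) C j) (filter (j ≤?_) (upTo (n ∸ 2))))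
  counted = trans (countInv-A₂ n k) (trans (length-admissible n j) (sym (trans summed pascal)))
theorem3p3 (suc m) 1 _ (s≤s ())
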